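{- Let $G$ be a graph, $U\subseteq V(G)$, and let $x,y\in\mathbb{A}^U$ be strings compatible with $(G,U)$, witnessed by partial solutions $S_x,S_y\subseteq V(G)$ such that $|S_x\setminus U|\equiv|S_y\setminus U|\pmod m$. Then $\vec{s}(x)\cdot\vec{w}_m(y)\equiv\vec{s}(y)\cdot\vec{w}_m(x)\pmod m$.
   Context: Standing assumptions: $\sigma,\rho\subseteq\mathbb{Z}_{\ge0}$ are finite non-empty sets with $\rho\neq\{0\}$, and $(\sigma,\rho)$ is $m$-structured for an integer $m\ge2$, i.e., there are $B,B'$ with $r\equiv B\pmod m$ for all $r\in\rho$ and $s\equiv B'\pmod m$ for all $s\in\sigma$. $s_{\mathrm{top}}=\max\sigma$, $r_{\mathrm{top}}=\max\rho$, $\mathbb{A}=\{\sigma_0,\dots,\sigma_{s_{\mathrm{top}}},\rho_0,\dots,\rho_{r_{\mathrm{top}}}\}$. A partial solution of $(G,U)$ is $S\subseteq V(G)$ with $|N(v)\cap S|\in\rho$ for each $v\in V(G)\setminus(S\cup U)$ and $|N(v)\cap S|\in\sigma$ for each $v\in S\setminus U$. A string $x$ indexed by $U$ is compatible with $(G,U)$, witnessed by a partial solution $S$, if for all $v\in U$: $x[v]=\sigma_{|N(v)\cap S|}$ if $v\in S$ and $x[v]=\rho_{|N(v)\cap S|}$ if $v\notin S$. For $x\in\mathbb{A}^U$, $\vec{s}(x)\in\{0,1\}^U$ has $\vec s(x)[v]=1$ iff $x[v]$ is some $\sigma_c$; $\vec{w}_m(x)\in\mathbb{Z}_m^U$ has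 $\vec w_m(x)[v]=c\bmod m$ where $x[v]\in\{\sigma_c,\rho_c\}$; $\cdot$ is the standard inner product. -}

module Defs where

open import Data.Nat using (ℕ; zero; suc; _+_; _*_; _%_; _≤_; _⊔_; NonZero)
open import Data.Bool using (Bool; true; false; if_then_else_)
open import Data.Fin using (Fin)
open import Data.Fin.Subset using (Subset; _∈_; _∉_; _∩_; ∁; ∣_∣)
open import Data.Vec using (Vec; tabulate; lookup)
import Data.Vec as Vec
open import Data.List using (List; foldr)
import Data.List.Membership.Propositional as LM
open import Data.Product using (_×_; ∃; ∃₂)
open import Relation.Binary.PropositionalEquality using (_≡_)
open import Relation.Nullary using (¬_)

record Graph (n : ℕ) : Set where
  field
    adj   : Fin n → Fin n → Bool
    sym   : ∀ u v → adj u v ≡ adj v u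
    irref : ∀ v → adj v v ≡ false
open Graph public

N : ∀ {n} → Graph n → Fin n → Subset n
N G v = tabulate (adj G v)

deg : ∀ {n} → Graph n → Subset n → Fin n → ℕ
deg G S v = ∣ N G v ∩ S ∣

maxL : List ℕ → ℕ
maxL = foldr _⊔_ 0

data Letter : Set where
  σL : ℕ → Letter
  ρL : ℕ → Letter

InAlphabet : List ℕ → List ℕ → Letter → Set
InAlphabet σ ρ (σL c) = c ≤ maxL σ
InAlphabet σ ρ (ρL c) = c ≤ maxL ρ

PartialSolution : ∀ {n} → List ℕ → List ℕ → Graph n → Subset n → Subset n → Set
PartialSolution σ ρ G U S =
  ∀ v → v ∉ U →
    (v ∈ S → deg G S v LM.∈ σ) × (v ∉ S → deg G S v LM.∈ ρ)

-- strings indexed by U are represented as functions Fin n → Letter;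
-- only their values on U matter (all constraints and sums range over U).
String : ℕ → Set
String n = Fin n → Letter

-- x is compatible with (G,U), witnessed by S (S assumed a partial solution)
WitnessedBy : ∀ {n} → Graph n → Subset n → String n → Subset n → Set
WitnessedBy G U x S =
  ∀ v → v ∈ U → (v ∈ S → x v ≡ σL (deg G S v)) × (v ∉ S → x v ≡ ρL (deg G S v))

sVec : Letter → ℕ
sVec (σL _) = 1
sVec (ρL _) = 0

-- index c of the letter (w_m(x)[v] = c mod m)
idx : Letter → ℕ
idx (σL c) = c
idx (ρL c) = c

-- s(x) · w_m(y), computed in ℕ over the coordinates in U
-- (the result is to be read modulo m)
dot : ∀ {n} (m : ℕ) .{{_ : NonZero m}} → Subset n → String n → String n → ℕ
dot m U x y =
  Vec.sum (tabulate λ v →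
    if lookup U v then sVec (x v) * (idx (y v) % m) else 0)

diffSize : ∀ {n} → Subset n → Subset n → ℕ
diffSize S U = ∣ S ∩ ∁ U ∣

-- Count the ordered edges from Sx to Sy, which by symmetry of adjacency equals the
-- count from Sy to Sx, and split both counts into the vertices of U and the rest.
-- On U the count from Sx to Sy is s(x)·w(y) (mod m).  Outside U a vertex of Sx
-- contributes its Sy-degree, which mod m is B or B' according to whether the vertex
-- lies outside or inside Sy.  Writing B' ≡ B + δ, that part is
-- |Sx ∖ U|·B + |Sx ∩ Sy ∖ U|·δ, which is symmetric in x and y because
-- |Sx ∖ U| ≡ |Sy ∖ U|.  Cancelling it gives the claim.
module Submission where

open import Data.Nat using (ℕ; _%_; _≤_; NonZero)
open import Data.List using (List; [])
open import Data.List.Membership.Propositional using (_∈_)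
open import Data.Fin.Subset using (Subset) renaming (_∈_ to _∈ₛ_)
open import Data.Product using (_×_; ∃₂)
open import Relation.Binary.PropositionalEquality using (_≡_; _≢_)
open import Relation.Nullary using (¬_)
open import Function.Bundles using (_⇔_)

open import Defs hiding (sym)
open import Data.Nat using (zero; suc; _+_; _*_; pred)
open import Data.Nat.Properties
  using (+-*-semiring; +-identityʳ; *-identityˡ; *-identityʳ; *-zeroʳ; *-comm; *-assoc; *-suc;
         *-distribˡ-+; +-assoc; +-comm; suc-pred)
open import Data.Nat.DivMod using (%-distribˡ-+; %-distribˡ-*; m%n%n≡m%n; %-remove-+ʳ)
open import Data.Nat.Divisibility using (n∣m*n)
open import Data.Nat.Tactic.RingSolver using (solve-∀)
open import Algebra.Properties.Semiring.Sum +-*-semiring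
  using (sum; sum-cong-≗; ∑-comm; ∑-distrib-+; *-distribˡ-sum; *-distribʳ-sum)
open import Data.Bool using (Bool; true; false; if_then_else_; _∧_; not)
open import Data.Fin using (Fin; zero; suc)
open import Data.Fin.Subset using (_∉_; _∩_; ∁; ∣_∣)
open import Data.Fin.Subset.Properties using (_∈?_)
open import Data.Vec using ([]; _∷_; tabulate; lookup)
import Data.Vec as Vec
open import Data.Vec.Properties using (lookup∘tabulate; lookup-zipWith; lookup-map; []=⇒lookup; lookup⇒[]=)
open import Data.Product using (_,_; proj₁; proj₂; ∃)
open import Data.Empty using (⊥-elim)
open import Relation.Nullary using (yes; no)
open import Level using (0ℓ)
open import Relation.Binary.Bundles using (Setoid)
open import Relation.Binary.Structures using (IsEquivalence)
open import Relation.Binary.PropositionalEquality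
  using (refl; sym; trans; cong; cong₂; module ≡-Reasoning)
import Relation.Binary.Reasoning.Setoid as SetoidReasoning

private
  variable
    n : ℕ
    v : Fin n
    S T U : Subset n

sum-tabulate : (f : Fin n → ℕ) → Vec.sum (tabulate f) ≡ sum f
sum-tabulate {zero} f = refl
sum-tabulate {suc n} f = cong (f zero +_) (sum-tabulate (λ i → f (suc i)))

indicator : Bool → ℕ
indicator b = if b then 1 else 0

indicator-∧ : ∀ a b → indicator (a ∧ b) ≡ indicator a * indicator b
indicator-∧ true b = sym (+-identityʳ (indicator b))
indicator-∧ false b = refl

χ : Subset n → Fin n → ℕ
χ S v = indicator (lookup S v)

χ-∈ : v ∈ₛ S → χ S v ≡ 1
χ-∈ v∈S = cong indicator ([]=⇒lookup v∈S)

lookup≡false⇒∉ : lookup S v ≡ false → v ∉ S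
lookup≡false⇒∉ eq v∈S with trans (sym ([]=⇒lookup v∈S)) eq
... | ()

χ-∉ : v ∉ S → χ S v ≡ 0
χ-∉ {v = v} {S = S} v∉S with lookup S v in eq
... | true = ⊥-elim (v∉S (lookup⇒[]= v S eq))
... | false = refl

χ-∩ : (S T : Subset n) (v : Fin n) → χ (S ∩ T) v ≡ χ S v * χ T v
χ-∩ S T v = trans (cong indicator (lookup-zipWith _∧_ v S T)) (indicator-∧ (lookup S v) (lookup T v))

∣p∣≡∑χp : (S : Subset n) → ∣ S ∣ ≡ sum (χ S)
∣p∣≡∑χp [] = refl
∣p∣≡∑χp (true ∷ S) = cong suc (∣p∣≡∑χp S)
∣p∣≡∑χp (false ∷ S) = ∣p∣≡∑χp S

on off : Subset n → (Fin n → ℕ) → Fin n → ℕ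
on U f v = if lookup U v then f v else 0
off U f v = if lookup U v then 0 else f v

∑-on+off : (U : Subset n) (f : Fin n → ℕ) → sum f ≡ sum (on U f) + sum (off U f)
∑-on+off U f = trans (sum-cong-≗ split) (∑-distrib-+ (on U f) (off U f))
  where
  split : ∀ v → f v ≡ on U f v + off U f v
  split v with lookup U v
  ... | true = sym (+-identityʳ (f v))
  ... | false = refl

∣S∩∁U∣≡∑off : (S U : Subset n) → ∣ S ∩ ∁ U ∣ ≡ sum (off U (χ S))
∣S∩∁U∣≡∑off S U = trans (∣p∣≡∑χp (S ∩ ∁ U)) (sum-cong-≗ pointwise)
  where
  pointwise : ∀ v → χ (S ∩ ∁ U) v ≡ off U (χ S) v
  pointwise v rewrite χ-∩ S (∁ U) v | lookup-map v not U with lookup U v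
  ... | true = *-zeroʳ (χ S v)
  ... | false = *-identityʳ (χ S v)

∑off-affine : (U : Subset n) (a c : Fin n → ℕ) (b d : ℕ) →
  sum (off U (λ v → a v * (b + c v * d))) ≡ sum (off U a) * b + sum (off U (λ v → a v * c v)) * d
∑off-affine U a c b d = begin
  sum (off U (λ v → a v * (b + c v * d)))
    ≡⟨ sum-cong-≗ pointwise ⟩
  sum (λ v → off U a v * b + off U (λ v → a v * c v) v * d)
    ≡⟨ ∑-distrib-+ (λ v → off U a v * b) (λ v → off U (λ v → a v * c v) v * d) ⟩
  sum (λ v → off U a v * b) + sum (λ v → off U (λ v → a v * c v) v * d)
    ≡⟨ sym (cong₂ _+_ (*-distribʳ-sum b (off U a)) (*-distribʳ-sum d (off U (λ v → a v * c v)))) ⟩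
  sum (off U a) * b + sum (off U (λ v → a v * c v)) * d ∎
  where
  open ≡-Reasoning
  pointwise : ∀ v → off U (λ v → a v * (b + c v * d)) v ≡ off U a v * b + off U (λ v → a v * c v) v * d
  pointwise v with lookup U v
  ... | true = refl
  ... | false = trans (*-distribˡ-+ (a v) b (c v * d)) (cong (a v * b +_) (sym (*-assoc (a v) (c v) d)))

deg≡∑χ : (G : Graph n) (T : Subset n) (v : Fin n) → deg G T v ≡ sum (λ w → χ (N G v) w * χ T w)
deg≡∑χ G T v = trans (∣p∣≡∑χp (N G v ∩ T)) (sum-cong-≗ (χ-∩ (N G v) T))

χ-N-sym : (G : Graph n) (v w : Fin n) → χ (N G v) w ≡ χ (N G w) v
χ-N-sym G v w = cong indicator (begin
  lookup (N G v) w ≡⟨ lookup∘tabulate (adj G v) w ⟩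
  adj G v w        ≡⟨ Graph.sym G v w ⟩
  adj G w v        ≡⟨ sym (lookup∘tabulate (adj G w) v) ⟩
  lookup (N G w) v ∎)
  where open ≡-Reasoning

edgesBetween : Graph n → Subset n → Subset n → ℕ
edgesBetween G S T = sum (λ v → χ S v * deg G T v)

edgesBetween≡∑∑ : (G : Graph n) (S T : Subset n) →
  edgesBetween G S T ≡ sum (λ v → sum (λ w → χ S v * (χ (N G v) w * χ T w)))
edgesBetween≡∑∑ G S T = sum-cong-≗ λ v →
  trans (cong (χ S v *_) (deg≡∑χ G T v)) (*-distribˡ-sum (χ S v) (λ w → χ (N G v) w * χ T w))

edgesBetween-sym : (G : Graph n) (S T : Subset n) → edgesBetween G S T ≡ edgesBetween G T S
edgesBetween-sym G S T = begin
  edgesBetween G S T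
    ≡⟨ edgesBetween≡∑∑ G S T ⟩
  sum (λ v → sum (λ w → χ S v * (χ (N G v) w * χ T w)))
    ≡⟨ ∑-comm (λ v w → χ S v * (χ (N G v) w * χ T w)) ⟩
  sum (λ w → sum (λ v → χ S v * (χ (N G v) w * χ T w)))
    ≡⟨ sum-cong-≗ (λ w → sum-cong-≗ λ v → edge-sym v w) ⟩
  sum (λ w → sum (λ v → χ T w * (χ (N G w) v * χ S v)))
    ≡⟨ sym (edgesBetween≡∑∑ G T S) ⟩
  edgesBetween G T S ∎
  where
  open ≡-Reasoning
  swap : ∀ a e b → a * (e * b) ≡ b * (e * a)
  swap = solve-∀
  edge-sym : ∀ v w → χ S v * (χ (N G v) w * χ T w) ≡ χ T w * (χ (N G w) v * χ S v)
  edge-sym v w = trans (swap (χ S v) (χ (N G v) w) (χ T w)) (cong (λ e → χ T w * (e * χ S v)) (χ-N-sym G v w))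

edgesOn edgesOff : Graph n → Subset n → Subset n → Subset n → ℕ
edgesOn G U S T = sum (on U (λ v → χ S v * deg G T v))
edgesOff G U S T = sum (off U (λ v → χ S v * deg G T v))

sVec-witnessed : {G : Graph n} {U S : Subset n} {x : String n} →
  WitnessedBy G U x S → v ∈ₛ U → sVec (x v) ≡ χ S v
sVec-witnessed {v = v} {S = S} wx v∈U with v ∈? S
... | yes v∈S rewrite proj₁ (wx v v∈U) v∈S = sym (χ-∈ v∈S)
... | no v∉S rewrite proj₂ (wx v v∈U) v∉S = sym (χ-∉ v∉S)

idx-witnessed : {G : Graph n} {U S : Subset n} {x : String n} →
  WitnessedBy G U x S → v ∈ₛ U → idx (x v) ≡ deg G S v
idx-witnessed {v = v} {S = S} wx v∈U with v ∈? S
... | yes v∈S rewrite proj₁ (wx v v∈U) v∈S = refl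
... | no v∉S rewrite proj₂ (wx v v∈U) v∉S = refl

module Modular (m : ℕ) .{{_ : NonZero m}} where

  infix 4 _≡ₘ_
  record _≡ₘ_ (a b : ℕ) : Set where
    constructor mod
    field residue-≡ : a % m ≡ b % m
  open _≡ₘ_ public

  ≡ₘ-isEquivalence : IsEquivalence _≡ₘ_
  ≡ₘ-isEquivalence = record
    { refl = mod refl
    ; sym = λ (mod p) → mod (sym p)
    ; trans = λ (mod p) (mod q) → mod (trans p q)
    }

  ≡ₘ-setoid : Setoid 0ℓ 0ℓ
  ≡ₘ-setoid = record { isEquivalence = ≡ₘ-isEquivalence }

  open IsEquivalence ≡ₘ-isEquivalence public
    using () renaming (refl to ≡ₘ-refl; sym to ≡ₘ-sym; trans to ≡ₘ-trans)

  ≡⇒≡ₘ : ∀ {a b} → a ≡ b → a ≡ₘ b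
  ≡⇒≡ₘ refl = ≡ₘ-refl

  +-cong : ∀ {a a' b b'} → a ≡ₘ a' → b ≡ₘ b' → a + b ≡ₘ a' + b'
  +-cong {a} {a'} {b} {b'} (mod p) (mod q) = mod (begin
    (a + b) % m             ≡⟨ %-distribˡ-+ a b m ⟩
    (a % m + b % m) % m     ≡⟨ cong₂ (λ s t → (s + t) % m) p q ⟩
    (a' % m + b' % m) % m   ≡⟨ sym (%-distribˡ-+ a' b' m) ⟩
    (a' + b') % m           ∎)
    where open ≡-Reasoning

  *-cong : ∀ {a a' b b'} → a ≡ₘ a' → b ≡ₘ b' → a * b ≡ₘ a' * b'
  *-cong {a} {a'} {b} {b'} (mod p) (mod q) = mod (begin
    (a * b) % m             ≡⟨ %-distribˡ-* a b m ⟩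
    (a % m * (b % m)) % m   ≡⟨ cong₂ (λ s t → (s * t) % m) p q ⟩
    (a' % m * (b' % m)) % m ≡⟨ sym (%-distribˡ-* a' b' m) ⟩
    (a' * b') % m           ∎)
    where open ≡-Reasoning

  a%m≡ₘa : ∀ a → a % m ≡ₘ a
  a%m≡ₘa a = mod (m%n%n≡m%n a m)

  a+c*m≡ₘa : ∀ a c → a + c * m ≡ₘ a
  a+c*m≡ₘa a c = mod (%-remove-+ʳ a (n∣m*n c))

  c*m≡c+c*pred[m] : ∀ c → c * m ≡ c + c * pred m
  c*m≡c+c*pred[m] c = trans (cong (c *_) (sym (suc-pred m))) (*-suc c (pred m))

  +-cancelʳ : ∀ {a b} c → a + c ≡ₘ b + c → a ≡ₘ b
  +-cancelʳ {a} {b} c a+c≡b+c = begin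
    a                   ≈⟨ ≡ₘ-sym (a+c*m≡ₘa a c) ⟩
    a + c * m           ≡⟨ shift a ⟩
    a + c + c * pred m  ≈⟨ +-cong a+c≡b+c ≡ₘ-refl ⟩
    b + c + c * pred m  ≡⟨ sym (shift b) ⟩
    b + c * m           ≈⟨ a+c*m≡ₘa b c ⟩
    b                   ∎
    where
    open SetoidReasoning ≡ₘ-setoid
    shift : ∀ a → a + c * m ≡ a + c + c * pred m
    shift a = trans (cong (a +_) (c*m≡c+c*pred[m] c)) (sym (+-assoc a c (c * pred m)))

  offset : ∀ a b → ∃ λ d → a + d ≡ₘ b
  offset a b = b + a * pred m , ≡ₘ-trans (≡⇒≡ₘ a+d≡b+a*m) (a+c*m≡ₘa b a)
    where
    open ≡-Reasoning
    a+d≡b+a*m : a + (b + a * pred m) ≡ b + a * m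
    a+d≡b+a*m = begin
      a + (b + a * pred m) ≡⟨ sym (+-assoc a b _) ⟩
      a + b + a * pred m   ≡⟨ cong (_+ a * pred m) (+-comm a b) ⟩
      b + a + a * pred m   ≡⟨ +-assoc b a _ ⟩
      b + (a + a * pred m) ≡⟨ cong (b +_) (sym (c*m≡c+c*pred[m] a)) ⟩
      b + a * m            ∎

  sum-cong : {f g : Fin n → ℕ} → (∀ v → f v ≡ₘ g v) → sum f ≡ₘ sum g
  sum-cong {zero} f≡g = ≡ₘ-refl
  sum-cong {suc n} f≡g = +-cong (f≡g zero) (sum-cong (λ v → f≡g (suc v)))

  on-cong : {f g : Fin n → ℕ} → (∀ v → v ∈ₛ U → f v ≡ₘ g v) → ∀ v → on U f v ≡ₘ on U g v
  on-cong {U = U} f≡g v with lookup U v in eq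
  ... | true = f≡g v (lookup⇒[]= v U eq)
  ... | false = ≡ₘ-refl

  off-cong : {f g : Fin n → ℕ} → (∀ v → v ∉ U → f v ≡ₘ g v) → ∀ v → off U f v ≡ₘ off U g v
  off-cong {U = U} f≡g v with lookup U v in eq
  ... | true = ≡ₘ-refl
  ... | false = f≡g v (lookup≡false⇒∉ eq)

  open SetoidReasoning ≡ₘ-setoid

  edgesOn-sym-≡ₘ : (G : Graph n) (U S T : Subset n) →
    edgesOff G U S T ≡ₘ edgesOff G U T S → edgesOn G U S T ≡ₘ edgesOn G U T S
  edgesOn-sym-≡ₘ G U S T off≡off = +-cancelʳ (edgesOff G U T S) (begin
    edgesOn G U S T + edgesOff G U T S ≈⟨ +-cong ≡ₘ-refl (≡ₘ-sym off≡off) ⟩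
    edgesOn G U S T + edgesOff G U S T ≡⟨ sym (∑-on+off U (λ v → χ S v * deg G T v)) ⟩
    edgesBetween G S T                 ≡⟨ edgesBetween-sym G S T ⟩
    edgesBetween G T S                 ≡⟨ ∑-on+off U (λ v → χ T v * deg G S v) ⟩
    edgesOn G U T S + edgesOff G U T S ∎)

  dot≡ₘedgesOn : (G : Graph n) (U S T : Subset n) (x y : String n) →
    WitnessedBy G U x S → WitnessedBy G U y T → dot m U x y ≡ₘ edgesOn G U S T
  dot≡ₘedgesOn G U S T x y wx wy = begin
    dot m U x y                                     ≡⟨ sum-tabulate (on U (λ v → sVec (x v) * (idx (y v) % m))) ⟩
    sum (on U (λ v → sVec (x v) * (idx (y v) % m))) ≈⟨ sum-cong (on-cong letter≡ₘ) ⟩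
    edgesOn G U S T                                 ∎
    where
    letter≡ₘ : ∀ v → v ∈ₛ U → sVec (x v) * (idx (y v) % m) ≡ₘ χ S v * deg G T v
    letter≡ₘ v v∈U = *-cong (≡⇒≡ₘ (sVec-witnessed {G = G} {S = S} {x = x} wx v∈U))
                            (≡ₘ-trans (a%m≡ₘa (idx (y v))) (≡⇒≡ₘ (idx-witnessed {G = G} {S = T} {x = y} wy v∈U)))

  module _ {σ ρ : List ℕ} {B δ : ℕ}
           (ρ≡ₘB : ∀ r → r ∈ ρ → r ≡ₘ B) (σ≡ₘB+δ : ∀ s → s ∈ σ → s ≡ₘ B + δ)
           (G : Graph n) (U : Subset n) where

    deg-off-≡ₘ : (T : Subset n) (v : Fin n) → PartialSolution σ ρ G U T → v ∉ U →
      deg G T v ≡ₘ B + χ T v * δ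
    deg-off-≡ₘ T v psT v∉U with v ∈? T
    ... | yes v∈T rewrite χ-∈ v∈T | *-identityˡ δ = σ≡ₘB+δ _ (proj₁ (psT v v∉U) v∈T)
    ... | no v∉T rewrite χ-∉ v∉T | +-identityʳ B = ρ≡ₘB _ (proj₂ (psT v v∉U) v∉T)

    edgesOff-≡ₘ : (S T : Subset n) → PartialSolution σ ρ G U T →
      edgesOff G U S T ≡ₘ diffSize S U * B + sum (off U (λ v → χ S v * χ T v)) * δ
    edgesOff-≡ₘ S T psT = begin
      edgesOff G U S T
        ≈⟨ sum-cong (off-cong term≡ₘ) ⟩
      sum (off U (λ v → χ S v * (B + χ T v * δ)))
        ≡⟨ ∑off-affine U (χ S) (χ T) B δ ⟩
      sum (off U (χ S)) * B + sum (off U (λ v → χ S v * χ T v)) * δ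
        ≡⟨ cong (λ k → k * B + sum (off U (λ v → χ S v * χ T v)) * δ) (sym (∣S∩∁U∣≡∑off S U)) ⟩
      diffSize S U * B + sum (off U (λ v → χ S v * χ T v)) * δ ∎
      where
      term≡ₘ : ∀ v → v ∉ U → χ S v * deg G T v ≡ₘ χ S v * (B + χ T v * δ)
      term≡ₘ v v∉U = *-cong (≡ₘ-refl {χ S v}) (deg-off-≡ₘ T v psT v∉U)

    edgesOff-sym-≡ₘ : (S T : Subset n) → PartialSolution σ ρ G U S → PartialSolution σ ρ G U T →
      diffSize S U ≡ₘ diffSize T U → edgesOff G U S T ≡ₘ edgesOff G U T S
    edgesOff-sym-≡ₘ S T psS psT ∣S∖U∣≡∣T∖U∣ = begin
      edgesOff G U S T
        ≈⟨ edgesOff-≡ₘ S T psT ⟩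
      diffSize S U * B + sum (off U (λ v → χ S v * χ T v)) * δ
        ≈⟨ +-cong (*-cong ∣S∖U∣≡∣T∖U∣ ≡ₘ-refl) (≡⇒≡ₘ (cong (_* δ) (sum-cong-≗ χχ-comm))) ⟩
      diffSize T U * B + sum (off U (λ v → χ T v * χ S v)) * δ
        ≈⟨ ≡ₘ-sym (edgesOff-≡ₘ T S psS) ⟩
      edgesOff G U T S ∎
      where
      χχ-comm : ∀ v → off U (λ v → χ S v * χ T v) v ≡ off U (λ v → χ T v * χ S v) v
      χχ-comm v with lookup U v
      ... | true = refl
      ... | false = *-comm (χ S v) (χ T v)

lemma4p3 : (σ ρ : List ℕ) → σ ≢ [] → ρ ≢ [] → ¬ (∀ r → (r ∈ ρ) ⇔ (r ≡ 0)) →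
    (m : ℕ) .{{_ : NonZero m}} → 2 ≤ m →
    (∃₂ λ B B' → (∀ r → r ∈ ρ → r % m ≡ B % m) × (∀ s → s ∈ σ → s % m ≡ B' % m)) →
    ∀ {n} (G : Graph n) (U : Subset n) (x y : String n) (Sx Sy : Subset n) →
    (∀ v → v ∈ₛ U → InAlphabet σ ρ (x v)) →
    (∀ v → v ∈ₛ U → InAlphabet σ ρ (y v)) →
    PartialSolution σ ρ G U Sx → WitnessedBy G U x Sx →
    PartialSolution σ ρ G U Sy → WitnessedBy G U y Sy →
    diffSize Sx U % m ≡ diffSize Sy U % m →
    dot m U x y % m ≡ dot m U y x % m
lemma4p3 σ ρ _ _ _ m _ (B , B' , ρ≡B , σ≡B') G U x y Sx Sy _ _ psx wx psy wy ∣Sx∖U∣≡∣Sy∖U∣ =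
  residue-≡ (begin
    dot m U x y       ≈⟨ dot≡ₘedgesOn G U Sx Sy x y wx wy ⟩
    edgesOn G U Sx Sy ≈⟨ edgesOn-sym-≡ₘ G U Sx Sy offParts ⟩
    edgesOn G U Sy Sx ≈⟨ ≡ₘ-sym (dot≡ₘedgesOn G U Sy Sx y x wy wx) ⟩
    dot m U y x       ∎)
  where
  open Modular m
  open SetoidReasoning ≡ₘ-setoid
  δ : ℕ
  δ = proj₁ (offset B B')
  σ≡ₘB+δ : ∀ s → s ∈ σ → s ≡ₘ B + δ
  σ≡ₘB+δ s s∈σ = ≡ₘ-trans (mod (σ≡B' s s∈σ)) (≡ₘ-sym (proj₂ (offset B B')))
  offParts : edgesOff G U Sx Sy ≡ₘ edgesOff G U Sy Sx
  offParts = edgesOff-sym-≡ₘ (λ r r∈ρ → mod (ρ≡B r r∈ρ)) σ≡ₘB+δ G U Sx Sy psx psy (mod ∣Sx∖U∣≡∣Sy∖U∣)
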